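{- Let $n \geq 2$ and let $q$ be a prime power. For $x = (x_1,\dots,x_{n-1}) \in (\mathbb{F}_q^*)^{n-1}$ put $F_0(x) = \prod_{i=1}^{n-1} x_i$, $F_i(x) = x_i F_0(x)$ for $i \in \{1,\dots,n-1\}$, and $F(x) = \langle (1, F_0(x), F_1(x), \dots, F_{n-1}(x)) \rangle$, a point of $\mathrm{PG}(n,q)$. Let $X = \{F(x) : x \in (\mathbb{F}_q^*)^{n-1}\}$. Then no line of $\mathrm{PG}(n,q)$ intersects $X$ in more than $n$ points.
   Context: $\mathrm{PG}(n,q)$ is the projective space whose points and lines are the $1$- and $2$-dimensional subspaces of $\mathbb{F}_q^{n+1}$; $\mathbb{F}_q^* = \mathbb{F}_q \setminus \{0\}$. -}

module Defs where

open import Level using (Level; _⊔_)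
open import Data.Nat using (ℕ; zero; suc)
open import Data.Fin using (Fin; zero; suc)
open import Data.Product using (Σ; ∃; _×_; _,_)
open import Relation.Nullary using (¬_)
open import Relation.Binary.PropositionalEquality using (_≡_)
open import Algebra.Bundles using (CommutativeRing)

-- Every finite field has prime power order size = q, and F_q is unique
-- up to isomorphism, so quantifying over all finite fields is the same as
-- quantifying over all prime powers q.
record FiniteField (c ℓ : Level) : Set (Level.suc (c ⊔ ℓ)) where
  field
    commRing : CommutativeRing c ℓ
  open CommutativeRing commRing public
  field
    1≉0       : ¬ (1# ≈ 0#)
    inverse   : ∀ x → ¬ (x ≈ 0#) → Σ Carrier λ y → (x * y) ≈ 1#
    size      : ℕ
    enum      : Fin size → Carrier
    enum-surj : ∀ x → Σ (Fin size) λ i → enum i ≈ x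
    enum-inj  : ∀ i j → enum i ≈ enum j → i ≡ j

module _ {c ℓ : Level} (K : FiniteField c ℓ) where
  open FiniteField K using (Carrier; _≈_; _+_; _*_; 0#; 1#)

  prodF : (m : ℕ) → (Fin m → Carrier) → Carrier
  prodF zero    x = 1#
  prodF (suc m) x = x zero * prodF m (λ i → x (suc i))

  AllNonzero : (m : ℕ) → (Fin m → Carrier) → Set ℓ
  AllNonzero m x = ∀ i → ¬ (x i ≈ 0#)

  -- With n = suc m (so x ∈ (F_q^*)^{n-1}), the vector
  -- (1, F_0(x), F_1(x), ..., F_{n-1}(x)) ∈ F_q^{n+1},
  -- where F_0(x) = ∏ x_i and F_i(x) = x_i F_0(x).
  Fvec : (m : ℕ) → (Fin m → Carrier) → Fin (suc (suc m)) → Carrier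
  Fvec m x zero          = 1#
  Fvec m x (suc zero)    = prodF m x
  Fvec m x (suc (suc i)) = x i * prodF m x

  SamePoint : (k : ℕ) → (Fin k → Carrier) → (Fin k → Carrier) → Set (c ⊔ ℓ)
  SamePoint k u v = Σ Carrier λ λ′ → ¬ (λ′ ≈ 0#) × (∀ i → u i ≈ (λ′ * v i))

  -- u and w are linearly independent, so span{u,w} is a 2-dimensional
  -- subspace, i.e. a line of the projective space.
  LinIndep2 : (k : ℕ) → (Fin k → Carrier) → (Fin k → Carrier) → Set (c ⊔ ℓ)
  LinIndep2 k u w = ∀ a b → (∀ i → ((a * u i) + (b * w i)) ≈ 0#) → (a ≈ 0#) × (b ≈ 0#)

  OnLine : (k : ℕ) → (Fin k → Carrier) → (Fin k → Carrier) → (Fin k → Carrier) → Set (c ⊔ ℓ)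
  OnLine k u w v = Σ Carrier λ a → Σ Carrier λ b → ∀ i → v i ≈ ((a * u i) + (b * w i))

module Submission where

-- Normalise the line so that its points with first coordinate 1 are p + t d with d₀ = 0.
-- If F(x) = p + t d, the identity F₀(x)ⁿ = ∏ᵢ Fᵢ(x) says (p₁ + t d₁)ⁿ = ∏ᵢ₌₂ⁿ (pᵢ + t dᵢ), and
-- distinct points have distinct parameters t. If d₁ ≠ 0 this is a polynomial equation in t of
-- degree exactly n. If d₁ = 0 the left side is a constant, while the right side has degree
-- between 1 and n − 1: no factor vanishes identically because the coordinates of F(x) are
-- nonzero, and some dᵢ ≠ 0 because d ≠ 0. Either way at most n parameters, hence points, occur.

open import Defs

open import Level using (Level; _⊔_)
open import Data.Nat using (ℕ; zero; suc; _≤_; z≤n; s≤s; NonZero; >-nonZero)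
open import Data.Nat.Properties using (≤-trans; m≤n⇒m≤1+n)
open import Data.Fin using (Fin; zero; suc)
open import Data.Fin.Properties using (¬∀⟶∃¬)
open import Data.Vec using (Vec; []; _∷_; map)
open import Data.List using (List; []; _∷_; length)
open import Data.List.Relation.Unary.All as All using (All; []; _∷_)
open import Data.List.Relation.Unary.AllPairs using (AllPairs; []; _∷_)
open import Data.Product using (Σ; _×_; _,_; proj₁; proj₂)
open import Data.Sum using (_⊎_; inj₁; inj₂; [_,_]′)
open import Function using (_∘_)
open import Relation.Nullary using (¬_; Dec; yes; no; contradiction)
open import Relation.Binary.Definitions using (Decidable)
open import Relation.Binary.PropositionalEquality as ≡ using (_≡_)
open import Algebra.Bundles using (CommutativeRing; Semiring)

module Polynomials {c ℓ} (R : CommutativeRing c ℓ) where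
  open CommutativeRing R hiding (zero)
  open import Algebra.Definitions _≈_ using (AlmostLeftCancellative)
  open import Algebra.Definitions.RawSemiring (Semiring.rawSemiring semiring) using (product)
  open import Algebra.Properties.CommutativeSemiring.Exp commutativeSemiring using (_^_)
  open import Algebra.Properties.Ring ring using ([y-z]x≈yx-zx)
  open import Algebra.Properties.Group +-group
    using (//-rightDividesˡ; x∙y⁻¹≈ε⇒x≈y; x≈y⇒x∙y⁻¹≈ε; ∙-cancelʳ)
  open import Algebra.Solver.Ring.NaturalCoefficients.Default commutativeSemiring
  open import Relation.Binary.Reasoning.Setoid setoid

  -- Coefficient vectors list the constant term first.
  eval : ∀ {n} → Vec Carrier n → Carrier → Carrier
  eval []       t = 0#
  eval (a ∷ as) t = a + t * eval as t

  leading : ∀ {n} → Vec Carrier (suc n) → Carrier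
  leading (a ∷ [])     = a
  leading (_ ∷ a ∷ as) = leading (a ∷ as)

  leading-∷ : ∀ {n} z (v : Vec Carrier (suc n)) → leading (z ∷ v) ≡ leading v
  leading-∷ z (a ∷ as) = ≡.refl

  eval-constant : ∀ a t → eval (a ∷ []) t ≈ a
  eval-constant a t = solve 2 (λ a t → a :+ t :* con 0 := a) refl a t

  addConstant : ∀ {n} → Carrier → Vec Carrier (suc n) → Vec Carrier (suc n)
  addConstant z (a ∷ as) = (z + a) ∷ as

  eval-addConstant : ∀ {n} z (v : Vec Carrier (suc n)) t → eval (addConstant z v) t ≈ z + eval v t
  eval-addConstant z (a ∷ as) t = +-assoc z a (t * eval as t)

  leading-addConstant : ∀ {n} z (v : Vec Carrier (suc (suc n))) → leading (addConstant z v) ≡ leading v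
  leading-addConstant z (a ∷ b ∷ bs) = ≡.refl

  mulLinear : ∀ {n} → Carrier → Carrier → Vec Carrier (suc n) → Vec Carrier (suc (suc n))
  mulLinear a b (q ∷ [])      = a * q ∷ b * q ∷ []
  mulLinear a b (q ∷ q′ ∷ qs) = a * q ∷ addConstant (b * q) (mulLinear a b (q′ ∷ qs))

  eval-mulLinear : ∀ {n} a b (v : Vec Carrier (suc n)) t →
                   eval (mulLinear a b v) t ≈ (a + t * b) * eval v t
  eval-mulLinear a b (q ∷ []) t =
    solve 4 (λ a b q t → a :* q :+ t :* (b :* q :+ t :* con 0) := (a :+ t :* b) :* (q :+ t :* con 0))
      refl a b q t
  eval-mulLinear a b (q ∷ q′ ∷ qs) t = begin
    a * q + t * eval (addConstant (b * q) M) t  ≈⟨ +-congˡ (*-congˡ (eval-addConstant (b * q) M t)) ⟩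
    a * q + t * (b * q + eval M t)              ≈⟨ +-congˡ (*-congˡ (+-congˡ (eval-mulLinear a b (q′ ∷ qs) t))) ⟩
    a * q + t * (b * q + (a + t * b) * Q)       ≈⟨ solve 5 (λ a b q t Q → a :* q :+ t :* (b :* q :+ (a :+ t :* b) :* Q)
                                                                   := (a :+ t :* b) :* (q :+ t :* Q)) refl a b q t Q ⟩
    (a + t * b) * (q + t * Q)                   ∎
    where
    M = mulLinear a b (q′ ∷ qs)
    Q = eval (q′ ∷ qs) t

  leading-mulLinear : ∀ {n} a b (v : Vec Carrier (suc n)) → leading (mulLinear a b v) ≈ b * leading v
  leading-mulLinear a b (q ∷ [])      = refl
  leading-mulLinear a b (q ∷ q′ ∷ qs) =
    trans (reflexive (≡.trans (leading-∷ (a * q) (addConstant (b * q) M)) (leading-addConstant (b * q) M)))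
          (leading-mulLinear a b (q′ ∷ qs))
    where M = mulLinear a b (q′ ∷ qs)

  scale : ∀ {n} → Carrier → Vec Carrier n → Vec Carrier n
  scale z = map (z *_)

  eval-scale : ∀ {n} z (v : Vec Carrier n) t → eval (scale z v) t ≈ z * eval v t
  eval-scale z []       t = sym (zeroʳ z)
  eval-scale z (a ∷ as) t = begin
    z * a + t * eval (scale z as) t  ≈⟨ +-congˡ (*-congˡ (eval-scale z as t)) ⟩
    z * a + t * (z * A)              ≈⟨ solve 4 (λ z a t A → z :* a :+ t :* (z :* A) := z :* (a :+ t :* A)) refl z a t A ⟩
    z * (a + t * A)                  ∎
    where A = eval as t

  leading-scale : ∀ {n} z (v : Vec Carrier (suc n)) → leading (scale z v) ≡ z * leading v
  leading-scale z (a ∷ [])     = ≡.refl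
  leading-scale z (_ ∷ a ∷ as) = leading-scale z (a ∷ as)

  infixl 6 _⊖_
  _⊖_ : ∀ {n} → Vec Carrier (suc (suc n)) → Vec Carrier (suc n) → Vec Carrier (suc (suc n))
  (a ∷ as) ⊖ (b ∷ [])      = a - b ∷ as
  (a ∷ as) ⊖ (b ∷ b′ ∷ bs) = a - b ∷ as ⊖ (b′ ∷ bs)

  eval-⊖ : ∀ {n} (A : Vec Carrier (suc (suc n))) (B : Vec Carrier (suc n)) t →
           eval (A ⊖ B) t + eval B t ≈ eval A t
  eval-⊖ (a ∷ as) (b ∷ []) t = begin
    (a - b + t * X) + (b + t * 0#)  ≈⟨ solve 4 (λ x b t X → (x :+ t :* X) :+ (b :+ t :* con 0) := (x :+ b) :+ t :* X) refl (a - b) b t X ⟩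
    (a - b + b) + t * X             ≈⟨ +-congʳ (//-rightDividesˡ b a) ⟩
    a + t * X                       ∎
    where X = eval as t
  eval-⊖ (a ∷ as) (b ∷ b′ ∷ bs) t = begin
    (a - b + t * D) + (b + t * B)  ≈⟨ solve 5 (λ x b t D B → (x :+ t :* D) :+ (b :+ t :* B) := (x :+ b) :+ t :* (D :+ B)) refl (a - b) b t D B ⟩
    (a - b + b) + t * (D + B)      ≈⟨ +-cong (//-rightDividesˡ b a) (*-congˡ (eval-⊖ as (b′ ∷ bs) t)) ⟩
    a + t * eval as t              ∎
    where
    D = eval (as ⊖ (b′ ∷ bs)) t
    B = eval (b′ ∷ bs) t

  ⊖-root : ∀ {n} (A : Vec Carrier (suc (suc n))) (B : Vec Carrier (suc n)) {t} →
           eval A t ≈ eval B t → eval (A ⊖ B) t ≈ 0#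
  ⊖-root A B {t} A≈B = ∙-cancelʳ (eval B t) _ 0# (trans (eval-⊖ A B t) (trans A≈B (sym (+-identityˡ _))))

  leading-⊖ : ∀ {n} (A : Vec Carrier (suc (suc n))) (B : Vec Carrier (suc n)) → leading (A ⊖ B) ≡ leading A
  leading-⊖ (a ∷ b ∷ as) (_ ∷ [])      = ≡.refl
  leading-⊖ (a ∷ b ∷ as) (c ∷ b′ ∷ bs) =
    ≡.trans (leading-∷ (a - c) ((b ∷ as) ⊖ (b′ ∷ bs))) (leading-⊖ (b ∷ as) (b′ ∷ bs))

  linearPower : Carrier → Carrier → (n : ℕ) → Vec Carrier (suc n)
  linearPower a b zero    = 1# ∷ []
  linearPower a b (suc n) = mulLinear a b (linearPower a b n)

  eval-linearPower : ∀ a b n t → eval (linearPower a b n) t ≈ (a + t * b) ^ n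
  eval-linearPower a b zero    t = eval-constant 1# t
  eval-linearPower a b (suc n) t =
    trans (eval-mulLinear a b (linearPower a b n) t) (*-congˡ (eval-linearPower a b n t))

  leading-linearPower : ∀ a b n → leading (linearPower a b n) ≈ b ^ n
  leading-linearPower a b zero    = refl
  leading-linearPower a b (suc n) =
    trans (leading-mulLinear a b (linearPower a b n)) (*-congˡ (leading-linearPower a b n))

  linearProduct : ∀ m → (Fin m → Carrier) → (Fin m → Carrier) → Vec Carrier (suc m)
  linearProduct zero    a b = 1# ∷ []
  linearProduct (suc m) a b = mulLinear (a zero) (b zero) (linearProduct m (a ∘ suc) (b ∘ suc))

  eval-linearProduct : ∀ m a b t → eval (linearProduct m a b) t ≈ product (λ i → a i + t * b i)
  eval-linearProduct zero    a b t = eval-constant 1# t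
  eval-linearProduct (suc m) a b t =
    trans (eval-mulLinear (a zero) (b zero) (linearProduct m (a ∘ suc) (b ∘ suc)) t)
          (*-congˡ (eval-linearProduct m (a ∘ suc) (b ∘ suc) t))

  synthDiv : ∀ {n} → Vec Carrier (suc n) → Carrier → Vec Carrier n
  synthDiv (a ∷ [])      r = []
  synthDiv (a ∷ a′ ∷ as) r = eval (a′ ∷ as) r ∷ synthDiv (a′ ∷ as) r

  -- v(t) − v(r) = (t − r) q(t) for q = synthDiv v r, with both sides moved so that no subtraction occurs.
  eval-synthDiv : ∀ {n} (v : Vec Carrier (suc n)) r t →
                  eval v t + r * eval (synthDiv v r) t ≈ t * eval (synthDiv v r) t + eval v r
  eval-synthDiv (a ∷ []) r t =
    solve 3 (λ a t r → a :+ t :* con 0 :+ r :* con 0 := t :* con 0 :+ (a :+ r :* con 0)) refl a t r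
  eval-synthDiv (a ∷ a′ ∷ as) r t = begin
    (a + t * V) + r * (E + t * Q)  ≈⟨ solve 6 (λ a t r V E Q → (a :+ t :* V) :+ r :* (E :+ t :* Q)
                                                          := (a :+ r :* E) :+ t :* (V :+ r :* Q)) refl a t r V E Q ⟩
    (a + r * E) + t * (V + r * Q)  ≈⟨ +-congˡ (*-congˡ (eval-synthDiv (a′ ∷ as) r t)) ⟩
    (a + r * E) + t * (t * Q + E)  ≈⟨ solve 5 (λ a t r E Q → (a :+ r :* E) :+ t :* (t :* Q :+ E)
                                                        := t :* (E :+ t :* Q) :+ (a :+ r :* E)) refl a t r E Q ⟩
    t * (E + t * Q) + (a + r * E)  ∎
    where
    V = eval (a′ ∷ as) t
    E = eval (a′ ∷ as) r
    Q = eval (synthDiv (a′ ∷ as) r) t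

  leading-synthDiv : ∀ {n} (v : Vec Carrier (suc (suc n))) r → leading (synthDiv v r) ≈ leading v
  leading-synthDiv (a ∷ a′ ∷ [])       r = eval-constant a′ r
  leading-synthDiv (a ∷ a′ ∷ a″ ∷ as) r = leading-synthDiv (a′ ∷ a″ ∷ as) r

  record ExactLinearProduct (m : ℕ) (a b : Fin m → Carrier) : Set (c ⊔ ℓ) where
    field
      degree      : ℕ
      coeffs      : Vec Carrier (suc degree)
      eval-coeffs : ∀ t → eval coeffs t ≈ product (λ i → a i + t * b i)
      leading≉0   : leading coeffs ≉ 0#
      degree≤m    : degree ≤ m
      nonconstant : ∀ i → b i ≉ 0# → 1 ≤ degree

  module IntegralDomain (1≉0 : 1# ≉ 0#) (*-cancelˡ-nonZero : AlmostLeftCancellative 0# _*_) where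

    x≉0∧y≉0⇒x*y≉0 : ∀ {x y} → x ≉ 0# → y ≉ 0# → x * y ≉ 0#
    x≉0∧y≉0⇒x*y≉0 {x} {y} x≉0 y≉0 xy≈0 =
      y≉0 (*-cancelˡ-nonZero x y 0# x≉0 (trans xy≈0 (sym (zeroʳ x))))

    *-cancelʳ-≉ : ∀ {s r q} → s ≉ r → s * q ≈ r * q → q ≈ 0#
    *-cancelʳ-≉ {s} {r} {q} s≉r sq≈rq =
      *-cancelˡ-nonZero (s - r) q 0# (s≉r ∘ x∙y⁻¹≈ε⇒x≈y s r) (begin
        (s - r) * q        ≈⟨ [y-z]x≈yx-zx q s r ⟩
        s * q - r * q      ≈⟨ x≈y⇒x∙y⁻¹≈ε sq≈rq ⟩
        0#                 ≈⟨ zeroʳ (s - r) ⟨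
        (s - r) * 0#       ∎)

    synthDiv-root : ∀ {n} (v : Vec Carrier (suc n)) {r s} → s ≉ r → eval v s ≈ eval v r →
                    eval (synthDiv v r) s ≈ 0#
    synthDiv-root v {r} {s} s≉r vs≈vr = *-cancelʳ-≉ s≉r (∙-cancelʳ (eval v r) _ _ (begin
      s * Q + eval v r   ≈⟨ eval-synthDiv v r s ⟨
      eval v s + r * Q   ≈⟨ +-congʳ vs≈vr ⟩
      eval v r + r * Q   ≈⟨ +-comm (eval v r) (r * Q) ⟩
      r * Q + eval v r   ∎))
      where Q = eval (synthDiv v r) s

    roots-bound : ∀ d (v : Vec Carrier (suc d)) → leading v ≉ 0# → ∀ {ts} →
                  AllPairs _≉_ ts → All (λ t → eval v t ≈ 0#) ts → length ts ≤ d
    levelSet-bound : ∀ d .{{_ : NonZero d}} (v : Vec Carrier (suc d)) → leading v ≉ 0# → ∀ {c ts} →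
                     AllPairs _≉_ ts → All (λ t → eval v t ≈ c) ts → length ts ≤ d

    roots-bound d       v        _   {[]}    _ _         = z≤n
    roots-bound zero    (a ∷ []) a≉0 {_ ∷ _} _ (a≈0 ∷ _) = contradiction (trans (sym (eval-constant a _)) a≈0) a≉0
    roots-bound (suc d) v        v≉0 distinct roots      = levelSet-bound (suc d) v v≉0 distinct roots

    levelSet-bound (suc d) v _   {ts = []}     _ _ = z≤n
    levelSet-bound (suc d) v v≉0 {ts = r ∷ ts} (r≉ts ∷ distinct) (vr≈c ∷ vts≈c) =
      s≤s (roots-bound d (synthDiv v r) (v≉0 ∘ trans (sym (leading-synthDiv v r))) distinct
             (All.zipWith (λ (r≉t , vt≈c) → synthDiv-root v (r≉t ∘ sym) (trans vt≈c (sym vr≈c))) (r≉ts , vts≈c)))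

    -- Factors with b i ≈ 0 are nonzero constants and do not raise the degree.
    exactLinearProduct : Decidable _≈_ → ∀ m (a b : Fin m → Carrier) →
                         (∀ i → ¬ (a i ≈ 0# × b i ≈ 0#)) → ExactLinearProduct m a b
    exactLinearProduct _≟_ zero a b _ = record
      { degree = 0 ; coeffs = 1# ∷ [] ; eval-coeffs = eval-constant 1# ; leading≉0 = 1≉0
      ; degree≤m = z≤n ; nonconstant = λ () }
    exactLinearProduct _≟_ (suc m) a b nonzero with b zero ≟ 0#
    ... | no b₀≉0 = record
      { degree      = suc degree
      ; coeffs      = mulLinear (a zero) (b zero) coeffs
      ; eval-coeffs = λ t → trans (eval-mulLinear (a zero) (b zero) coeffs t) (*-congˡ (eval-coeffs t))
      ; leading≉0   = x≉0∧y≉0⇒x*y≉0 b₀≉0 leading≉0 ∘ trans (sym (leading-mulLinear (a zero) (b zero) coeffs))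
      ; degree≤m    = s≤s degree≤m
      ; nonconstant = λ _ _ → s≤s z≤n
      }
      where open ExactLinearProduct (exactLinearProduct _≟_ m (a ∘ suc) (b ∘ suc) (nonzero ∘ suc))
    ... | yes b₀≈0 = record
      { degree      = degree
      ; coeffs      = scale (a zero) coeffs
      ; eval-coeffs = λ t → trans (eval-scale (a zero) coeffs t) (*-cong (a₀≈ t) (eval-coeffs t))
      ; leading≉0   = x≉0∧y≉0⇒x*y≉0 a₀≉0 leading≉0 ∘ trans (sym (reflexive (leading-scale (a zero) coeffs)))
      ; degree≤m    = m≤n⇒m≤1+n degree≤m
      ; nonconstant = λ { zero b₀≉0 → contradiction b₀≈0 b₀≉0 ; (suc i) → nonconstant i }
      }
      where
      open ExactLinearProduct (exactLinearProduct _≟_ m (a ∘ suc) (b ∘ suc) (nonzero ∘ suc))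
      a₀≉0 : a zero ≉ 0#
      a₀≉0 a₀≈0 = nonzero zero (a₀≈0 , b₀≈0)
      a₀≈ : ∀ t → a zero ≈ a zero + t * b zero
      a₀≈ t = sym (trans (+-congˡ (trans (*-congˡ b₀≈0) (zeroʳ t))) (+-identityʳ (a zero)))

module _ {a b s} {A : Set a} {B : Set b} {S : A → B → Set s} where

  witnesses : ∀ {xs} → All (λ x → Σ B (S x)) xs → List B
  witnesses = All.reduce proj₁

  length-witnesses : ∀ {xs} (ws : All (λ x → Σ B (S x)) xs) → length (witnesses ws) ≡ length xs
  length-witnesses []       = ≡.refl
  length-witnesses (_ ∷ ws) = ≡.cong suc (length-witnesses ws)

  All-witnesses : ∀ {q} {Q : B → Set q} → (∀ {x t} → S x t → Q t) →
                  ∀ {xs} (ws : All (λ x → Σ B (S x)) xs) → All Q (witnesses ws)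
  All-witnesses f []             = []
  All-witnesses f ((_ , s) ∷ ws) = f s ∷ All-witnesses f ws

  AllPairs-witnesses : ∀ {r q} {R : A → A → Set r} {Q : B → B → Set q} →
                       (∀ {x y t u} → R x y → S x t → S y u → Q t u) →
                       ∀ {xs} (ws : All (λ x → Σ B (S x)) xs) → AllPairs R xs → AllPairs Q (witnesses ws)
  AllPairs-witnesses f []             []         = []
  AllPairs-witnesses {R = R} {Q} f {x ∷ _} ((t , s) ∷ ws) (rx ∷ rxs) = relatedToHead ws rx ∷ AllPairs-witnesses f ws rxs
    where
    relatedToHead : ∀ {ys} (vs : All (λ y → Σ B (S y)) ys) → All (λ y → R x y) ys → All (Q t) (witnesses vs)
    relatedToHead []              []       = []
    relatedToHead ((_ , s′) ∷ vs) (r ∷ rs) = f r s s′ ∷ relatedToHead vs rs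

module FiniteFieldProperties {c ℓ} (K : FiniteField c ℓ) where
  open FiniteField K
  open import Algebra.Definitions _≈_ using (AlmostLeftCancellative)
  open import Relation.Binary.Reasoning.Setoid setoid
  import Data.Fin as Fin

  infix 4 _≟_
  _≟_ : Decidable _≈_
  x ≟ y with enum-surj x | enum-surj y
  ... | i , eᵢ≈x | j , eⱼ≈y with i Fin.≟ j
  ...   | yes ≡.refl = yes (trans (sym eᵢ≈x) eⱼ≈y)
  ...   | no i≢j     = no (λ x≈y → i≢j (enum-inj i j (trans eᵢ≈x (trans x≈y (sym eⱼ≈y)))))

  *-cancelˡ-nonZero : AlmostLeftCancellative 0# _*_
  *-cancelˡ-nonZero x y z x≉0 xy≈xz with inverse x x≉0
  ... | x⁻¹ , xx⁻¹≈1 = begin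
    y                ≈⟨ *-identityˡ y ⟨
    1# * y           ≈⟨ *-congʳ (trans (*-comm x⁻¹ x) xx⁻¹≈1) ⟨
    (x⁻¹ * x) * y    ≈⟨ *-assoc x⁻¹ x y ⟩
    x⁻¹ * (x * y)    ≈⟨ *-congˡ xy≈xz ⟩
    x⁻¹ * (x * z)    ≈⟨ *-assoc x⁻¹ x z ⟨
    (x⁻¹ * x) * z    ≈⟨ *-congʳ (trans (*-comm x⁻¹ x) xx⁻¹≈1) ⟩
    1# * z           ≈⟨ *-identityˡ z ⟩
    z                ∎

module AffineLines {c ℓ} (K : FiniteField c ℓ) where
  open FiniteField K hiding (zero)
  open FiniteFieldProperties K
  open Polynomials commRing
  open IntegralDomain 1≉0 *-cancelˡ-nonZero
  open import Algebra.Definitions.RawSemiring (Semiring.rawSemiring semiring) using (product)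
  open import Algebra.Properties.CommutativeSemiring.Exp commutativeSemiring using (_^_; ^-congˡ)
  open import Algebra.Properties.CommutativeMonoid.Sum *-commutativeMonoid using (∑-distrib-+; sum-replicate; sum-cong-≋)
  open import Algebra.Properties.Ring ring using (-‿distribˡ-*; -‿distribʳ-*)
  open import Algebra.Properties.Group +-group using (x≈z//y)
  open import Algebra.Solver.Ring.NaturalCoefficients.Default commutativeSemiring
  open import Relation.Binary.Reasoning.Setoid setoid

  prodF≡product : ∀ m (x : Fin m → Carrier) → prodF K m x ≡ product x
  prodF≡product zero    x = ≡.refl
  prodF≡product (suc m) x = ≡.cong (x zero *_) (prodF≡product m (x ∘ suc))

  product-scale : ∀ m (x : Fin m → Carrier) z → product (λ i → x i * z) ≈ product x * z ^ m
  product-scale m x z = trans (∑-distrib-+ x (λ _ → z)) (*-congˡ (sum-replicate m))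

  ^-nonZero : ∀ {x} n → x ≉ 0# → x ^ n ≉ 0#
  ^-nonZero zero    x≉0 = 1≉0
  ^-nonZero (suc n) x≉0 = x≉0∧y≉0⇒x*y≉0 x≉0 (^-nonZero n x≉0)

  prodF-nonZero : ∀ m (x : Fin m → Carrier) → AllNonzero K m x → prodF K m x ≉ 0#
  prodF-nonZero zero    x _   = 1≉0
  prodF-nonZero (suc m) x x≉0 = x≉0∧y≉0⇒x*y≉0 (x≉0 zero) (prodF-nonZero m (x ∘ suc) (x≉0 ∘ suc))

  module AffineLine (m : ℕ) (p d : Fin (suc (suc m)) → Carrier) where

    AtParameter : (Fin m → Carrier) → Carrier → Set ℓ
    AtParameter x t = ∀ i → Fvec K m x i ≈ p i + t * d i

    a b : Fin m → Carrier
    a i = p (suc (suc i))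
    b i = d (suc (suc i))

    power≈product : ∀ {x t} → AtParameter x t →
                    (p (suc zero) + t * d (suc zero)) ^ suc m ≈ product (λ i → a i + t * b i)
    power≈product {x} {t} x≈p+td = begin
      (p (suc zero) + t * d (suc zero)) ^ suc m  ≈⟨ ^-congˡ (suc m) (x≈p+td (suc zero)) ⟨
      F₀ * F₀ ^ m                                ≈⟨ *-congʳ (reflexive (prodF≡product m x)) ⟩
      product x * F₀ ^ m                         ≈⟨ product-scale m x F₀ ⟨
      product (λ i → x i * F₀)                   ≈⟨ sum-cong-≋ (λ i → x≈p+td (suc (suc i))) ⟩
      product (λ i → a i + t * b i)              ∎
      where F₀ = prodF K m x

    samePoint : ∀ {x y t u} → AtParameter x t → AtParameter y u → t ≈ u →
                SamePoint K (suc (suc m)) (Fvec K m x) (Fvec K m y)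
    samePoint {x} {y} {t} {u} x≈p+td y≈p+ud t≈u = 1# , 1≉0 , λ i → begin
      Fvec K m x i       ≈⟨ x≈p+td i ⟩
      p i + t * d i      ≈⟨ +-congˡ (*-congʳ t≈u) ⟩
      p i + u * d i      ≈⟨ y≈p+ud i ⟨
      Fvec K m y i       ≈⟨ *-identityˡ _ ⟨
      1# * Fvec K m y i  ∎

    factor-nonZero : ∀ {x t} → AllNonzero K m x → AtParameter x t → ∀ i → ¬ (a i ≈ 0# × b i ≈ 0#)
    factor-nonZero {x} {t} x≉0 x≈p+td i (aᵢ≈0 , bᵢ≈0) =
      x≉0∧y≉0⇒x*y≉0 (x≉0 i) (prodF-nonZero m x x≉0) (begin
        x i * prodF K m x   ≈⟨ x≈p+td (suc (suc i)) ⟩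
        a i + t * b i       ≈⟨ +-cong aᵢ≈0 (trans (*-congˡ bᵢ≈0) (zeroʳ t)) ⟩
        0# + 0#             ≈⟨ +-identityʳ 0# ⟩
        0#                  ∎)

    some-b≉0 : ¬ (∀ i → d (suc i) ≈ 0#) → d (suc zero) ≈ 0# → Σ (Fin m) λ i → b i ≉ 0#
    some-b≉0 d≢0 d₁≈0 with ¬∀⟶∃¬ (suc m) (λ j → d (suc j) ≈ 0#) (λ j → d (suc j) ≟ 0#) d≢0
    ... | zero  , d₁≉0 = contradiction d₁≈0 d₁≉0
    ... | suc i , bᵢ≉0 = i , bᵢ≉0

    points-bound : ¬ (∀ i → d (suc i) ≈ 0#) → ∀ {xs} → All (AllNonzero K m) xs →
                   (ws : All (λ x → Σ Carrier (AtParameter x)) xs) →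
                   AllPairs (λ x y → ¬ SamePoint K (suc (suc m)) (Fvec K m x) (Fvec K m y)) xs →
                   length xs ≤ suc m
    points-bound d≢0 []        []                    _        = z≤n
    points-bound d≢0 (x≉0 ∷ _) ws@((_ , x≈p+td) ∷ _) distinct =
      ≡.subst (_≤ suc m) (length-witnesses ws) (bound (d₁ ≟ 0#))
      where
      p₁ = p (suc zero)
      d₁ = d (suc zero)
      ts-distinct : AllPairs _≉_ (witnesses ws)
      ts-distinct = AllPairs-witnesses (λ ¬same s s′ t≈u → ¬same (samePoint s s′ t≈u)) ws distinct
      bound : Dec (d₁ ≈ 0#) → length (witnesses ws) ≤ suc m
      bound (no d₁≉0) = roots-bound (suc m) (A ⊖ B) leading≉0 ts-distinct
        (All-witnesses (λ s → ⊖-root A B (trans (eval-linearPower p₁ d₁ (suc m) _)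
                                         (trans (power≈product s) (sym (eval-linearProduct m a b _))))) ws)
        where
        A = linearPower p₁ d₁ (suc m)
        B = linearProduct m a b
        leading≉0 : leading (A ⊖ B) ≉ 0#
        leading≉0 = ^-nonZero (suc m) d₁≉0 ∘ trans (sym (leading-linearPower p₁ d₁ (suc m)))
                                          ∘ trans (reflexive (≡.sym (leading-⊖ A B)))
      bound (yes d₁≈0) with some-b≉0 d≢0 d₁≈0
      ... | i , bᵢ≉0 = ≤-trans
        (levelSet-bound degree {{>-nonZero (nonconstant i bᵢ≉0)}} coeffs leading≉0 ts-distinct
          (All-witnesses level ws))
        (m≤n⇒m≤1+n degree≤m)
        where
        open ExactLinearProduct (exactLinearProduct _≟_ m a b (factor-nonZero x≉0 x≈p+td))
        level : ∀ {x t} → AtParameter x t → eval coeffs t ≈ p₁ ^ suc m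
        level {t = t} s = begin
          eval coeffs t                   ≈⟨ eval-coeffs t ⟩
          product (λ i → a i + t * b i)   ≈⟨ power≈product s ⟨
          (p₁ + t * d₁) ^ suc m           ≈⟨ ^-congˡ (suc m) (trans (+-congˡ (trans (*-congˡ d₁≈0) (zeroʳ t))) (+-identityʳ p₁)) ⟩
          p₁ ^ suc m                      ∎

  module Normalised {m} (u w : Fin (suc (suc m)) → Carrier) (ι : Carrier) (u₀ι≈1 : u zero * ι ≈ 1#) where

    k : Carrier
    k = - (w zero * ι)

    p d : Fin (suc (suc m)) → Carrier
    p i = ι * u i
    d i = w i + k * u i

    open AffineLine m p d public

    u₀≉0 : u zero ≉ 0#
    u₀≉0 u₀≈0 = 1≉0 (trans (sym u₀ι≈1) (trans (*-congʳ u₀≈0) (zeroˡ ι)))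

    k*u₀≈-w₀ : k * u zero ≈ - w zero
    k*u₀≈-w₀ = begin
      - (w zero * ι) * u zero     ≈⟨ -‿distribˡ-* (w zero * ι) (u zero) ⟨
      - (w zero * ι * u zero)     ≈⟨ -‿cong (*-assoc (w zero) ι (u zero)) ⟩
      - (w zero * (ι * u zero))   ≈⟨ -‿cong (*-congˡ (trans (*-comm ι (u zero)) u₀ι≈1)) ⟩
      - (w zero * 1#)             ≈⟨ -‿cong (*-identityʳ (w zero)) ⟩
      - w zero                    ∎

    d≢0 : LinIndep2 K (suc (suc m)) u w → ¬ (∀ i → d (suc i) ≈ 0#)
    d≢0 independent d≈0 = 1≉0 (proj₂ (independent k 1# λ i →
      trans (+-comm (k * u i) (1# * w i)) (trans (+-congʳ (*-identityˡ (w i))) (d≈0′ i))))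
      where
      d≈0′ : ∀ i → d i ≈ 0#
      d≈0′ zero    = trans (+-congˡ k*u₀≈-w₀) (-‿inverseʳ (w zero))
      d≈0′ (suc i) = d≈0 i

    -- A point a u + b w of the line with first coordinate 1 has a ≈ ι + b k, so it is p + b d.
    atParameter : ∀ {x} → OnLine K (suc (suc m)) u w (Fvec K m x) → Σ Carrier (AtParameter x)
    atParameter {x} (a , b , x≈au+bw) = b , λ i → begin
      Fvec K m x i                 ≈⟨ x≈au+bw i ⟩
      a * u i + b * w i            ≈⟨ +-congʳ (*-congʳ a≈ι+bk) ⟩
      (ι + b * k) * u i + b * w i  ≈⟨ solve 5 (λ ι b k uᵢ wᵢ → (ι :+ b :* k) :* uᵢ :+ b :* wᵢ
                                                         := ι :* uᵢ :+ b :* (wᵢ :+ k :* uᵢ)) refl ι b k (u i) (w i) ⟩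
      ι * u i + b * d i            ∎
      where
      a≈ι+bk : a ≈ ι + b * k
      a≈ι+bk = *-cancelˡ-nonZero (u zero) a (ι + b * k) u₀≉0 (begin
        u zero * a                   ≈⟨ *-comm (u zero) a ⟩
        a * u zero                   ≈⟨ x≈z//y _ _ _ (sym (x≈au+bw zero)) ⟩
        1# - b * w zero              ≈⟨ +-congˡ (-‿distribʳ-* b (w zero)) ⟩
        1# + b * - w zero            ≈⟨ +-cong (sym (trans (*-comm ι (u zero)) u₀ι≈1)) (*-congˡ (sym k*u₀≈-w₀)) ⟩
        ι * u zero + b * (k * u zero) ≈⟨ solve 4 (λ ι b k u₀ → ι :* u₀ :+ b :* (k :* u₀) := (ι :+ b :* k) :* u₀) refl ι b k (u zero) ⟩
        (ι + b * k) * u zero         ≈⟨ *-comm (ι + b * k) (u zero) ⟩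
        u zero * (ι + b * k)         ∎)

  line-bound : ∀ {m} (u w : Fin (suc (suc m)) → Carrier) → LinIndep2 K (suc (suc m)) u w → u zero ≉ 0# →
               ∀ {xs} → All (AllNonzero K m) xs →
               All (λ x → OnLine K (suc (suc m)) u w (Fvec K m x)) xs →
               AllPairs (λ x y → ¬ SamePoint K (suc (suc m)) (Fvec K m x) (Fvec K m y)) xs →
               length xs ≤ suc m
  line-bound u w independent u₀≉0 nonzero onLine distinct with inverse (u zero) u₀≉0
  ... | ι , u₀ι≈1 = points-bound (d≢0 independent) nonzero (All.map atParameter onLine) distinct
    where open Normalised u w ι u₀ι≈1

  LinIndep2-swap : ∀ {n} {u w : Fin n → Carrier} → LinIndep2 K n u w → LinIndep2 K n w u
  LinIndep2-swap independent a b au+bw≈0 with independent b a (λ i → trans (+-comm _ _) (au+bw≈0 i))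
  ... | b≈0 , a≈0 = a≈0 , b≈0

  OnLine-swap : ∀ {n} {u w v : Fin n → Carrier} → OnLine K n u w v → OnLine K n w u v
  OnLine-swap (a , b , v≈au+bw) = b , a , λ i → trans (v≈au+bw i) (+-comm _ _)

  OnLine⇒u₀≉0⊎w₀≉0 : ∀ {n} {u w v : Fin (suc n) → Carrier} → OnLine K (suc n) u w v → v zero ≉ 0# →
                     u zero ≉ 0# ⊎ w zero ≉ 0#
  OnLine⇒u₀≉0⊎w₀≉0 {u = u} {w} {v} (a , b , v≈au+bw) v₀≉0 with u zero ≟ 0#
  ... | no u₀≉0  = inj₁ u₀≉0
  ... | yes u₀≈0 = inj₂ λ w₀≈0 → v₀≉0 (begin
    v zero                   ≈⟨ v≈au+bw zero ⟩
    a * u zero + b * w zero  ≈⟨ +-cong (trans (*-congˡ u₀≈0) (zeroʳ a)) (trans (*-congˡ w₀≈0) (zeroʳ b)) ⟩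
    0# + 0#                  ≈⟨ +-identityʳ 0# ⟩
    0#                       ∎)

-- The bound holds for m = 0 as well.
lemma4 : {c ℓ : Level} (K : FiniteField c ℓ) (m : ℕ) → 1 ≤ m →
    (u w : Fin (suc (suc m)) → FiniteField.Carrier K) →
    LinIndep2 K (suc (suc m)) u w →
    (xs : List (Fin m → FiniteField.Carrier K)) →
    All (AllNonzero K m) xs →
    All (λ x → OnLine K (suc (suc m)) u w (Fvec K m x)) xs →
    AllPairs (λ x y → ¬ SamePoint K (suc (suc m)) (Fvec K m x) (Fvec K m y)) xs →
    length xs ≤ suc m
lemma4 K m _ u w independent []       _       _      _        = z≤n
lemma4 K m _ u w independent (x ∷ xs) nonzero onLine distinct =
  [ (λ u₀≉0 → line-bound u w independent u₀≉0 nonzero onLine distinct)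
  , (λ w₀≉0 → line-bound w u (LinIndep2-swap independent) w₀≉0 nonzero (All.map OnLine-swap onLine) distinct)
  ]′ (OnLine⇒u₀≉0⊎w₀≉0 (All.head onLine) 1≉0)
  where
  open FiniteField K using (1≉0)
  open AffineLines K
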